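{- A filter $\mathcal{F}$ on a semigroup $G$ respects recurrence if and only if every $\mathcal{F}$-large $H\subseteq G$ is recurrently $n$-thick in $A$ for every $A\subseteq G$ and every $n\ge 0$.
   Context: A filter $\mathcal{F}$ on $G$: nonempty family of subsets not containing $\emptyset$, closed upward and under finite intersections; $\mathcal{F}$-large means in $\mathcal{F}$; $\mathcal{F}$-small means the complement is in $\mathcal{F}$; $\mathcal{F}$-positive means not $\mathcal{F}$-small. "$\exists^\mathcal{F} g\in G\, P(g)$" means $\{g : P(g)\}$ is $\mathcal{F}$-positive. $Ag^{ -1}:=\{h : hg\in A\}$, $\partial_gA := A\cap Ag^{ -1}$. Recurrence: $A$ is $0$-recurrent if $\mathcal{F}$-positive; for $n\ge1$, $\Delta^n(A) := \{g : \partial_gA \text{ is } (n-1)\text{ -recurrent}\}$ and $A$ is $n$-recurrent if $\Delta^n(A)$ is $\mathcal{F}$-positive. $\mathcal{F}$ respects recurrence if for all $n\ge1$ and all $A,\tilde A$ with $A\triangle\tilde A$ $\mathcal{F}$-small, $A$ is $n$-recurrent iff $\tilde A$ is. Recurrent thickness: $D$ is recurrently $0$-thick in $A$ if either $A$ is $\mathcal{F}$-small or $A\cap D$ is $\mathcal{F}$-positive; for $n\ge1$, $D$ is recurrently $n$-thick in $A$ if either $A$ is not $n$-recurrent, or $\exists^\mathcal{F} g\in G$ such that $\partial_gA$ is $(n-1)$-recurrent and $\partial_g D$ is recurrently $(n-1)$-thick in $\partial_g A$. -}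

module Defs where

open import Level using (Level; Lift)
open import Data.Empty using (⊥)
open import Data.Nat using (ℕ; zero; suc)
open import Data.Product using (Σ; _×_; _,_)
open import Data.Sum using (_⊎_)
open import Relation.Nullary using (¬_)
open import Relation.Unary using (Pred; ∁; _∩_; _∪_; _⊆_)

record IsFilter {ℓ : Level} {G : Set ℓ} (F : Pred (Pred G ℓ) ℓ) : Set (Level.suc ℓ) where
  field
    nonempty  : Σ (Pred G ℓ) F
    no-empty  : ¬ F (λ _ → Lift ℓ ⊥)
    upward    : ∀ {A B : Pred G ℓ} → F A → A ⊆ B → F B
    intersect : ∀ {A B : Pred G ℓ} → F A → F B → F (A ∩ B)

_△_ : {ℓ : Level} {G : Set ℓ} → Pred G ℓ → Pred G ℓ → Pred G ℓ
A △ B = (A ∩ ∁ B) ∪ (B ∩ ∁ A)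

module FilterNotions {ℓ : Level} {G : Set ℓ} (_∙_ : G → G → G) (F : Pred (Pred G ℓ) ℓ) where

  Large : Pred G ℓ → Set ℓ
  Large A = F A

  Small : Pred G ℓ → Set ℓ
  Small A = F (∁ A)

  Positive : Pred G ℓ → Set ℓ
  Positive A = ¬ Small A

  ExistsF : Pred G ℓ → Set ℓ
  ExistsF P = Positive P

  -- A g⁻¹ := {h : h g ∈ A}
  shift : Pred G ℓ → G → Pred G ℓ
  shift A g h = A (h ∙ g)

  ∂ : G → Pred G ℓ → Pred G ℓ
  ∂ g A = A ∩ shift A g

  mutual
    Recurrent : ℕ → Pred G ℓ → Set ℓ
    Recurrent zero    A = Positive A
    Recurrent (suc n) A = Positive (Δ n A)

    -- Δ n A is the paper's Δ^{n+1}(A) = {g : ∂_g A is n-recurrent}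
    Δ : ℕ → Pred G ℓ → Pred G ℓ
    Δ n A g = Recurrent n (∂ g A)

  RespectsRecurrence : Set (Level.suc ℓ)
  RespectsRecurrence =
    ∀ (n : ℕ) (A Ã : Pred G ℓ) → Small (A △ Ã) →
      (Recurrent (suc n) A → Recurrent (suc n) Ã) × (Recurrent (suc n) Ã → Recurrent (suc n) A)

  RecThick : ℕ → Pred G ℓ → Pred G ℓ → Set ℓ
  RecThick zero    D A = Small A ⊎ Positive (A ∩ D)
  RecThick (suc n) D A =
    (¬ Recurrent (suc n) A) ⊎
    ExistsF (λ g → Recurrent n (∂ g A) × RecThick n (∂ g D) (∂ g A))

module Submission where

-- The proof rests on a characterisation of recurrent thickness (classically):
-- D is recurrently n-thick in A  iff  n-recurrence of A implies n-recurrence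
-- of A ∩ D.  Both sides unfold in parallel over n, using only that
-- n-recurrence is monotone under inclusion and that ∂_g commutes with ∩.
--
-- With this characterisation the theorem reduces to comparing A with A ∩ H:
--  * (⇒) for large H, A △ (A ∩ H) ⊆ ∁ H is small, so for n ≥ 1 respecting
--    recurrence transfers recurrence from A to A ∩ H; for n = 0 every
--    filter already sends positive A to positive A ∩ H.
--  * (⇐) if A △ Ã is small then H := ∁ (A △ Ã) is large, so thickness of H
--    makes A ∩ H recurrent, and A ∩ H ⊆ Ã gives recurrence of Ã by
--    monotonicity (and symmetrically).

open import Defs
open import Level using (Level)
open import Data.Nat using (ℕ; zero; suc)
open import Data.Product using (_×_; _,_; proj₁)
open import Data.Sum using (inj₁; inj₂; swap)
open import Data.Empty using (⊥-elim)
open import Relation.Nullary using (yes; no)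
open import Relation.Binary.PropositionalEquality using (_≡_)
open import Relation.Unary using (Pred; _⊆_; _∩_; ∁)
open import Algebra.Structures using (IsSemigroup)
open import Axiom.ExcludedMiddle using (ExcludedMiddle)
open import Axiom.DoubleNegationElimination using (em⇒dne)

module RecurrenceAndThickness {ℓ : Level} {G : Set ℓ} (_∙_ : G → G → G)
  (F : Pred (Pred G ℓ) ℓ) (isFilter : IsFilter F) where
  open IsFilter isFilter
  open FilterNotions _∙_ F

  positive-mono : {A B : Pred G ℓ} → A ⊆ B → Positive A → Positive B
  positive-mono A⊆B posA smallB = posA (upward smallB (λ x∉B x∈A → x∉B (A⊆B x∈A)))

  ∂-mono : ∀ {g} {A B : Pred G ℓ} → A ⊆ B → ∂ g A ⊆ ∂ g B
  ∂-mono A⊆B (a , a') = A⊆B a , A⊆B a'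

  ∂-∩⁺ : ∀ {g} {A D : Pred G ℓ} → ∂ g (A ∩ D) ⊆ ∂ g A ∩ ∂ g D
  ∂-∩⁺ ((a , d) , (a' , d')) = (a , a') , (d , d')

  ∂-∩⁻ : ∀ {g} {A D : Pred G ℓ} → ∂ g A ∩ ∂ g D ⊆ ∂ g (A ∩ D)
  ∂-∩⁻ ((a , a') , (d , d')) = (a , d) , (a' , d')

  recurrent-mono : ∀ n {A B : Pred G ℓ} → A ⊆ B → Recurrent n A → Recurrent n B
  recurrent-mono zero    A⊆B = positive-mono A⊆B
  recurrent-mono (suc n) {A} {B} A⊆B =
    positive-mono (λ {g} → recurrent-mono n (∂-mono {g} {A} {B} A⊆B))

  KeepsRecurrent : ℕ → Pred G ℓ → Pred G ℓ → Set ℓ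
  KeepsRecurrent n D A = Recurrent n A → Recurrent n (A ∩ D)

  thick⇒keeps : ∀ n {D A : Pred G ℓ} → RecThick n D A → KeepsRecurrent n D A
  thick⇒keeps zero    (inj₁ smallA) posA = ⊥-elim (posA smallA)
  thick⇒keeps zero    (inj₂ posA∩D) _    = posA∩D
  thick⇒keeps (suc n) (inj₁ ¬recA)  recA = ⊥-elim (¬recA recA)
  thick⇒keeps (suc n) {D} {A} (inj₂ witnesses) _ = positive-mono keep witnesses
    where
    keep : ∀ {g} → Recurrent n (∂ g A) × RecThick n (∂ g D) (∂ g A) → Δ n (A ∩ D) g
    keep {g} (rec∂A , thick∂) =
      recurrent-mono n (∂-∩⁻ {g} {A} {D}) (thick⇒keeps n thick∂ rec∂A)

  keeps⇒thick : ExcludedMiddle ℓ → ∀ n {D A : Pred G ℓ} →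
    KeepsRecurrent n D A → RecThick n D A
  keeps⇒thick em zero {D} {A} keeps with em {Small A}
  ... | yes smallA = inj₁ smallA
  ... | no  posA   = inj₂ (keeps posA)
  keeps⇒thick em (suc n) {D} {A} keeps with em {Recurrent (suc n) A}
  ... | no  ¬recA = inj₁ ¬recA
  ... | yes recA  = inj₂ (positive-mono witness (keeps recA))
    where
    witness : ∀ {g} → Δ n (A ∩ D) g → Recurrent n (∂ g A) × RecThick n (∂ g D) (∂ g A)
    witness {g} rec∂A∩D =
      recurrent-mono n (λ x → proj₁ (∂-∩⁺ {g} {A} {D} x)) rec∂A∩D ,
      keeps⇒thick em n (λ _ → recurrent-mono n (∂-∩⁺ {g} {A} {D}) rec∂A∩D)

  large-keeps-positive : ∀ {H A : Pred G ℓ} → Large H → KeepsRecurrent zero H A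
  large-keeps-positive largeH posA smallA∩H =
    posA (upward (intersect smallA∩H largeH) (λ (x∉A∩H , x∈H) x∈A → x∉A∩H (x∈A , x∈H)))

  -- A and A ∩ H differ only outside H.
  △-cut-small : ∀ {H A : Pred G ℓ} → Large H → Small (A △ (A ∩ H))
  △-cut-small largeH = upward largeH λ
    { x∈H (inj₁ (x∈A , x∉A∩H))    → x∉A∩H (x∈A , x∈H)
    ; x∈H (inj₂ ((x∈A , _) , x∉A)) → x∉A x∈A }

  cut-by-agreement : ExcludedMiddle ℓ → (A Ã : Pred G ℓ) → A ∩ ∁ (A △ Ã) ⊆ Ã
  cut-by-agreement em A Ã (x∈A , x∉A△Ã) = em⇒dne em (λ x∉Ã → x∉A△Ã (inj₁ (x∈A , x∉Ã)))

  EveryLargeSetThick : Set (Level.suc ℓ)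
  EveryLargeSetThick = ∀ (H : Pred G ℓ) → Large H → ∀ (A : Pred G ℓ) (n : ℕ) → RecThick n H A

  -- (⇒): a large H keeps every A recurrent, at level 0 by the filter laws
  -- and at higher levels because A and A ∩ H differ on a small set.
  respects⇒thick : ExcludedMiddle ℓ → RespectsRecurrence → EveryLargeSetThick
  respects⇒thick em respects H largeH A n = keeps⇒thick em n (keeps n)
    where
    keeps : ∀ n → KeepsRecurrent n H A
    keeps zero    = large-keeps-positive largeH
    keeps (suc m) = proj₁ (respects m A (A ∩ H) (△-cut-small largeH))

  small-△-sym : ∀ {A Ã : Pred G ℓ} → Small (A △ Ã) → Small (Ã △ A)
  small-△-sym smallA△Ã = upward smallA△Ã (λ x∉A△Ã x∈Ã△A → x∉A△Ã (swap x∈Ã△A))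

  -- If every large set is thick, recurrence passes from A to any Ã that
  -- differs from A on a small set: A ∩ ∁ (A △ Ã) stays recurrent and lies in Ã.
  thick⇒transfer : ExcludedMiddle ℓ → EveryLargeSetThick → ∀ n {A Ã : Pred G ℓ} →
    Small (A △ Ã) → Recurrent n A → Recurrent n Ã
  thick⇒transfer em thick n {A} {Ã} smallA△Ã recA =
    recurrent-mono n (cut-by-agreement em A Ã)
      (thick⇒keeps n (thick (∁ (A △ Ã)) smallA△Ã A n) recA)

  thick⇒respects : ExcludedMiddle ℓ → EveryLargeSetThick → RespectsRecurrence
  thick⇒respects em thick n A Ã smallA△Ã =
    thick⇒transfer em thick (suc n) smallA△Ã ,
    thick⇒transfer em thick (suc n) (small-△-sym smallA△Ã)

mainTheorem7 : {ℓ : Level} → ExcludedMiddle ℓ →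
    (G : Set ℓ) (_∙_ : G → G → G) → IsSemigroup _≡_ _∙_ →
    (F : Pred (Pred G ℓ) ℓ) → IsFilter F →
    (FilterNotions.RespectsRecurrence _∙_ F →
       ∀ (H : Pred G ℓ) → FilterNotions.Large _∙_ F H →
         ∀ (A : Pred G ℓ) (n : ℕ) → FilterNotions.RecThick _∙_ F n H A)
    × ((∀ (H : Pred G ℓ) → FilterNotions.Large _∙_ F H →
         ∀ (A : Pred G ℓ) (n : ℕ) → FilterNotions.RecThick _∙_ F n H A) →
       FilterNotions.RespectsRecurrence _∙_ F)
mainTheorem7 em G _∙_ _ F isFilter = respects⇒thick em , thick⇒respects em
  where open RecurrenceAndThickness _∙_ F isFilter
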